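{- Let $H$ be a graph and $(G,\sigma)$ a signed graph. Then $\tilde{H}$ is a topological minor of $(G,\sigma)$ if and only if $\tilde{H}$ is a total topological minor of $(G,\sigma)$.
   Context: A signed graph $(G,\sigma)$ is a graph $G$ (loops and parallel edges allowed) with a signature $\sigma:E(G)\to\{+,-\}$; the sign of a path or cycle is the product of the signs of its edges. For a graph $H$, $\tilde H$ is the signed graph obtained by replacing each edge of $H$ with two parallel edges, one positive and one negative. A signed graph $(H,\pi)$ is a topological minor of $(G,\sigma)$ if (i) some subdivision of $H$ is isomorphic to a subgraph $G_1$ of $G$, and (ii) for every cycle $C$ of $(H,\pi)$, the image of $C$ in $G_1$ has the same sign in $(G,\sigma)$ as $C$ has in $(H,\pi)$. It is a total topological minor of $(G,\sigma)$ if (i) some subdivision of $H$ is isomorphic to a subgraph $G_1$ of $G$, and (ii) for every edge $e$ of $H$, the path $P_e$ of $G_1$ representing $e$ has sign $\pi(e)$ in $(G,\sigma)$ (for a suitable choice of the isomorphism). -}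

module Defs where

open import Data.Nat using (ℕ; _+_)
open import Data.Fin using (Fin; splitAt)
open import Data.Sign using (Sign) renaming (_*_ to _·_; + to pos; - to neg)
open import Data.List using (List; []; _∷_; foldr; map)
open import Data.List.Membership.Propositional using (_∈_; _∉_)
open import Data.List.Relation.Unary.Unique.Propositional using (Unique)
open import Data.Product using (_×_; Σ; Σ-syntax)
open import Data.Sum using (_⊎_; [_,_]′)
open import Function using (const)
open import Relation.Binary.PropositionalEquality using (_≡_; _≢_)

-- A finite graph; loops (src e ≡ tgt e) and parallel edges are allowed.
-- Edges are undirected: the src/tgt labelling of an edge is irrelevant (see Joins).
record Graph : Set where
  field
    nV  : ℕ
    nE  : ℕ
    src : Fin nE → Fin nV
    tgt : Fin nE → Fin nV

open Graph public

module _ (G : Graph) where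

  Joins : Fin (nE G) → Fin (nV G) → Fin (nV G) → Set
  Joins e u w = (src G e ≡ u × tgt G e ≡ w) ⊎ (src G e ≡ w × tgt G e ≡ u)

  data Walk : Fin (nV G) → Fin (nV G) → Set where
    edge : ∀ {u v} (e : Fin (nE G)) → Joins e u v → Walk u v
    cons : ∀ {u w v} (e : Fin (nE G)) → Joins e u w → Walk w v → Walk u v

  edges : ∀ {u v} → Walk u v → List (Fin (nE G))
  edges (edge e _)   = e ∷ []
  edges (cons e _ p) = e ∷ edges p

  inner : ∀ {u v} → Walk u v → List (Fin (nV G))
  inner (edge _ _)           = []
  inner (cons {w = w} _ _ p) = w ∷ inner p

  -- a path from u to v (if u ≢ v), or a cycle through u (if u ≡ v):
  -- distinct edges, distinct internal vertices, ends not internal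
  IsPath : ∀ {u v} → Walk u v → Set
  IsPath {u} {v} p = Unique (edges p) × Unique (inner p) × u ∉ inner p × v ∉ inner p

  IsCycle : ∀ {u} → Walk u u → Set
  IsCycle = IsPath

Signature : Graph → Set
Signature G = Fin (nE G) → Sign

signOf : ∀ {m} → (Fin m → Sign) → List (Fin m) → Sign
signOf σ es = foldr _·_ pos (map σ es)

-- A subdivision of H isomorphic to a subgraph G₁ of G, described by
-- branch vertices φ and, for every edge e of H, the path of G₁ representing e.
record Embedding (H G : Graph) : Set where
  field
    φ        : Fin (nV H) → Fin (nV G)
    φ-inj    : ∀ a b → φ a ≡ φ b → a ≡ b
    path     : (e : Fin (nE H)) → Walk G (φ (src H e)) (φ (tgt H e))
    path-ok  : ∀ e → IsPath G (path e)
    avoid    : ∀ e x → x ∈ inner G (path e) → ∀ a → φ a ≢ x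
    disj-inner : ∀ e f → e ≢ f → ∀ x → x ∈ inner G (path e) → x ∉ inner G (path f)
    disj-edges : ∀ e f → e ≢ f → ∀ g → g ∈ edges G (path e) → g ∉ edges G (path f)

open Embedding public

pathSign : ∀ {H G} → Signature G → Embedding H G → Fin (nE H) → Sign
pathSign σ M e = signOf σ (edges _ (path M e))

TopologicalMinor : (H : Graph) → Signature H → (G : Graph) → Signature G → Set
TopologicalMinor H π G σ =
  Σ[ M ∈ Embedding H G ]
    (∀ u (C : Walk H u u) → IsCycle H C →
       signOf (pathSign σ M) (edges H C) ≡ signOf π (edges H C))

TotalTopologicalMinor : (H : Graph) → Signature H → (G : Graph) → Signature G → Set
TotalTopologicalMinor H π G σ =
  Σ[ M ∈ Embedding H G ] (∀ e → pathSign σ M e ≡ π e)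

-- H̃: each edge doubled; edges in the first copy positive, in the second negative
tilde : Graph → Graph
tilde H = record
  { nV  = nV H
  ; nE  = nE H + nE H
  ; src = λ e → [ src H , src H ]′ (splitAt (nE H) e)
  ; tgt = λ e → [ tgt H , tgt H ]′ (splitAt (nE H) e)
  }

tildeSign : (H : Graph) → Signature (tilde H)
tildeSign H e = [ const pos , const neg ]′ (splitAt (nE H) e)

-- The two copies of an edge of H are either two 1-cycles of H̃ (if the edge is a loop) or
-- together a 2-cycle, so the cycle condition forces the paths representing them to have
-- opposite signs. The embedding may therefore be rerouted along the automorphism of H̃ that
-- swaps the two copies exactly where the positive copy is represented by a negative path;
-- the rerouted embedding realises every edge of H̃ with its own sign.
module Submission where

open import Defs
open import Data.Fin using (Fin; splitAt; join; _↑ˡ_; _↑ʳ_; _≟_)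
open import Data.Fin.Properties using (splitAt-↑ˡ; splitAt-↑ʳ; splitAt-join; join-splitAt)
open import Data.Sign using (Sign) renaming (_*_ to _·_; + to pos; - to neg)
open import Data.Sign.Properties using (s*s≡+; *-assoc; *-identityʳ)
open import Data.List using ([]; _∷_)
open import Data.List.Membership.Propositional using (_∈_)
open import Data.List.Relation.Unary.All using ([]; _∷_)
open import Data.List.Relation.Unary.AllPairs using ([]; _∷_)
open import Data.List.Relation.Unary.Any using (here)
open import Data.Product using (_,_)
open import Data.Sum using (_⊎_; inj₁; inj₂; [_,_]′; reduce; swap)
open import Data.Sum.Properties using (swap-involutive; [,]-∘)
open import Function using (const)
open import Function.Bundles using (_⇔_; mk⇔)
open import Function.Definitions using (Injective)
open import Relation.Nullary using (yes; no)
open import Relation.Binary.PropositionalEquality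
open ≡-Reasoning

x·y≡z⇒y≡x·z : ∀ x y z → x · y ≡ z → y ≡ x · z
x·y≡z⇒y≡x·z x y z xy≡z = begin
  y           ≡⟨ cong (_· y) (s*s≡+ x) ⟨
  (x · x) · y ≡⟨ *-assoc x x y ⟩
  x · (x · y) ≡⟨ cong (x ·_) xy≡z ⟩
  x · z       ∎

signOf-cong : ∀ {m} {f g : Fin m → Sign} → (∀ e → f e ≡ g e) → ∀ es → signOf f es ≡ signOf g es
signOf-cong f≗g []       = refl
signOf-cong f≗g (e ∷ es) = cong₂ _·_ (f≗g e) (signOf-cong f≗g es)

signOf-singleton : ∀ {m} (f : Fin m → Sign) e → signOf f (e ∷ []) ≡ f e
signOf-singleton f e = *-identityʳ (f e)

signOf-pair : ∀ {m} (f : Fin m → Sign) e e′ → signOf f (e ∷ e′ ∷ []) ≡ f e · f e′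
signOf-pair f e e′ = cong (f e ·_) (*-identityʳ (f e′))

module _ (G : Graph) where

  edges-subst₂ : ∀ {u u′ v v′} (p : u ≡ u′) (q : v ≡ v′) (w : Walk G u v) →
                 edges G (subst₂ (Walk G) p q w) ≡ edges G w
  edges-subst₂ refl refl w = refl

  inner-subst₂ : ∀ {u u′ v v′} (p : u ≡ u′) (q : v ≡ v′) (w : Walk G u v) →
                 inner G (subst₂ (Walk G) p q w) ≡ inner G w
  inner-subst₂ refl refl w = refl

  isPath-subst₂ : ∀ {u u′ v v′} (p : u ≡ u′) (q : v ≡ v′) {w : Walk G u v} →
                  IsPath G w → IsPath G (subst₂ (Walk G) p q w)
  isPath-subst₂ refl refl isPath = isPath

  loop-isCycle : ∀ {e u} (j : Joins G e u u) → IsCycle G (edge e j)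
  loop-isCycle j = [] ∷ [] , [] , (λ ()) , (λ ())

  digon-isCycle : ∀ {e f u v} → e ≢ f → u ≢ v → (je : Joins G e u v) (jf : Joins G f v u) →
                  IsCycle G (cons e je (edge f jf))
  digon-isCycle e≢f u≢v je jf =
    (e≢f ∷ []) ∷ [] ∷ [] , [] ∷ [] , (λ { (here u≡v) → u≢v u≡v }) , (λ { (here u≡v) → u≢v u≡v })

-- Representing each edge e of K by the path of another edge τ e with the same ends.
module Precompose {K G : Graph} (M : Embedding K G)
         (τ : Fin (nE K) → Fin (nE K)) (τ-inj : Injective _≡_ _≡_ τ)
         (src-τ : ∀ e → src K (τ e) ≡ src K e) (tgt-τ : ∀ e → tgt K (τ e) ≡ tgt K e) where

  private
    reroute : ∀ e → Walk G (φ M (src K (τ e))) (φ M (tgt K (τ e))) →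
              Walk G (φ M (src K e)) (φ M (tgt K e))
    reroute e = subst₂ (Walk G) (cong (φ M) (src-τ e)) (cong (φ M) (tgt-τ e))

    edges-reroute : ∀ e → edges G (reroute e (path M (τ e))) ≡ edges G (path M (τ e))
    edges-reroute e = edges-subst₂ G _ _ (path M (τ e))

    inner-reroute : ∀ e → inner G (reroute e (path M (τ e))) ≡ inner G (path M (τ e))
    inner-reroute e = inner-subst₂ G _ _ (path M (τ e))

  precompose : Embedding K G
  precompose = record
    { φ          = φ M
    ; φ-inj      = φ-inj M
    ; path       = λ e → reroute e (path M (τ e))
    ; path-ok    = λ e → isPath-subst₂ G _ _ (path-ok M (τ e))
    ; avoid      = λ e x x∈ → avoid M (τ e) x (subst (x ∈_) (inner-reroute e) x∈)
    ; disj-inner = λ e f e≢f x x∈e x∈f → disj-inner M (τ e) (τ f) (λ eq → e≢f (τ-inj eq)) x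
                     (subst (x ∈_) (inner-reroute e) x∈e) (subst (x ∈_) (inner-reroute f) x∈f)
    ; disj-edges = λ e f e≢f g g∈e g∈f → disj-edges M (τ e) (τ f) (λ eq → e≢f (τ-inj eq)) g
                     (subst (g ∈_) (edges-reroute e) g∈e) (subst (g ∈_) (edges-reroute f) g∈f)
    }

  pathSign-precompose : ∀ σ e → pathSign σ precompose e ≡ pathSign σ M (τ e)
  pathSign-precompose σ e = cong (signOf σ) (edges-reroute e)

swapIf : ∀ {A : Set} → Sign → A ⊎ A → A ⊎ A
swapIf pos x = x
swapIf neg x = swap x

swapIf-involutive : ∀ {A : Set} s (x : A ⊎ A) → swapIf s (swapIf s x) ≡ x
swapIf-involutive pos x = refl
swapIf-involutive neg x = swap-involutive x

reduce-swapIf : ∀ {A : Set} s (x : A ⊎ A) → reduce (swapIf s x) ≡ reduce x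
reduce-swapIf pos x        = refl
reduce-swapIf neg (inj₁ a) = refl
reduce-swapIf neg (inj₂ a) = refl

copySign : ∀ {A B : Set} → A ⊎ B → Sign
copySign = [ const pos , const neg ]′

copySign-swapIf : ∀ {A : Set} s (x : A ⊎ A) → copySign (swapIf s x) ≡ s · copySign x
copySign-swapIf pos x        = refl
copySign-swapIf neg (inj₁ a) = refl
copySign-swapIf neg (inj₂ a) = refl

module Tilde (H : Graph) where

  private
    n = nE H
    T = tilde H
    π = tildeSign H

  base : Fin (nE T) → Fin n
  base e = reduce (splitAt n e)

  src-tilde : ∀ e → src T e ≡ src H (base e)
  src-tilde e = sym ([,]-∘ (src H) (splitAt n e))

  tgt-tilde : ∀ e → tgt T e ≡ tgt H (base e)
  tgt-tilde e = sym ([,]-∘ (tgt H) (splitAt n e))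

  joins-↑ˡ : ∀ i → Joins T (i ↑ˡ n) (src H i) (tgt H i)
  joins-↑ˡ i = inj₁ ( cong [ src H , src H ]′ (splitAt-↑ˡ n i n)
                    , cong [ tgt H , tgt H ]′ (splitAt-↑ˡ n i n))

  joins-↑ʳ : ∀ i → Joins T (n ↑ʳ i) (tgt H i) (src H i)
  joins-↑ʳ i = inj₂ ( cong [ src H , src H ]′ (splitAt-↑ʳ n n i)
                    , cong [ tgt H , tgt H ]′ (splitAt-↑ʳ n n i))

  tildeSign-↑ˡ : ∀ i → π (i ↑ˡ n) ≡ pos
  tildeSign-↑ˡ i = cong copySign (splitAt-↑ˡ n i n)

  tildeSign-↑ʳ : ∀ i → π (n ↑ʳ i) ≡ neg
  tildeSign-↑ʳ i = cong copySign (splitAt-↑ʳ n n i)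

  ↑ˡ≢↑ʳ : ∀ i → i ↑ˡ n ≢ n ↑ʳ i
  ↑ˡ≢↑ʳ i eq with trans (sym (splitAt-↑ˡ n i n)) (trans (cong (splitAt n) eq) (splitAt-↑ʳ n n i))
  ... | ()

  flip : (Fin n → Sign) → Fin (nE T) → Fin (nE T)
  flip s e = join n n (swapIf (s (base e)) (splitAt n e))

  module _ (s : Fin n → Sign) where

    splitAt-flip : ∀ e → splitAt n (flip s e) ≡ swapIf (s (base e)) (splitAt n e)
    splitAt-flip e = splitAt-join n n _

    base-flip : ∀ e → base (flip s e) ≡ base e
    base-flip e = trans (cong reduce (splitAt-flip e)) (reduce-swapIf (s (base e)) (splitAt n e))

    flip-involutive : ∀ e → flip s (flip s e) ≡ e
    flip-involutive e = begin
      join n n (swapIf (s (base (flip s e))) (splitAt n (flip s e)))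
        ≡⟨ cong₂ (λ t x → join n n (swapIf (s t) x)) (base-flip e) (splitAt-flip e) ⟩
      join n n (swapIf (s (base e)) (swapIf (s (base e)) (splitAt n e)))
        ≡⟨ cong (join n n) (swapIf-involutive (s (base e)) (splitAt n e)) ⟩
      join n n (splitAt n e)
        ≡⟨ join-splitAt n n e ⟩
      e ∎

    flip-injective : Injective _≡_ _≡_ (flip s)
    flip-injective {e} {f} eq = begin
      e                 ≡⟨ flip-involutive e ⟨
      flip s (flip s e) ≡⟨ cong (flip s) eq ⟩
      flip s (flip s f) ≡⟨ flip-involutive f ⟩
      f                 ∎

    src-flip : ∀ e → src T (flip s e) ≡ src T e
    src-flip e = trans (src-tilde (flip s e)) (trans (cong (src H) (base-flip e)) (sym (src-tilde e)))

    tgt-flip : ∀ e → tgt T (flip s e) ≡ tgt T e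
    tgt-flip e = trans (tgt-tilde (flip s e)) (trans (cong (tgt H) (base-flip e)) (sym (tgt-tilde e)))

  module _ {G : Graph} (σ : Signature G) (M : Embedding T G)
           (cyc : ∀ u (C : Walk T u u) → IsCycle T C →
                  signOf (pathSign σ M) (edges T C) ≡ signOf π (edges T C)) where

    private
      ρ = pathSign σ M

    loop-sign : ∀ {e u} → Joins T e u u → ρ e ≡ π e
    loop-sign {e} j = begin
      ρ e               ≡⟨ signOf-singleton ρ e ⟨
      signOf ρ (e ∷ []) ≡⟨ cyc _ (edge e j) (loop-isCycle T j) ⟩
      signOf π (e ∷ []) ≡⟨ signOf-singleton π e ⟩
      π e               ∎

    copies-product : ∀ i → ρ (i ↑ˡ n) · ρ (n ↑ʳ i) ≡ π (i ↑ˡ n) · π (n ↑ʳ i)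
    copies-product i with src H i ≟ tgt H i
    ... | yes loop = cong₂ _·_
      (loop-sign (subst (Joins T (i ↑ˡ n) (src H i)) (sym loop) (joins-↑ˡ i)))
      (loop-sign (subst (Joins T (n ↑ʳ i) (tgt H i)) loop (joins-↑ʳ i)))
    ... | no nonloop = begin
      ρ (i ↑ˡ n) · ρ (n ↑ʳ i)             ≡⟨ signOf-pair ρ (i ↑ˡ n) (n ↑ʳ i) ⟨
      signOf ρ ((i ↑ˡ n) ∷ (n ↑ʳ i) ∷ []) ≡⟨ cyc (src H i) digon digon-cycle ⟩
      signOf π ((i ↑ˡ n) ∷ (n ↑ʳ i) ∷ []) ≡⟨ signOf-pair π (i ↑ˡ n) (n ↑ʳ i) ⟩
      π (i ↑ˡ n) · π (n ↑ʳ i)             ∎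
      where
      digon : Walk T (src H i) (src H i)
      digon = cons (i ↑ˡ n) (joins-↑ˡ i) (edge (n ↑ʳ i) (joins-↑ʳ i))

      digon-cycle : IsCycle T digon
      digon-cycle = digon-isCycle T (↑ˡ≢↑ʳ i) nonloop (joins-↑ˡ i) (joins-↑ʳ i)

    copies-opposite : ∀ i → ρ (i ↑ˡ n) · ρ (n ↑ʳ i) ≡ neg
    copies-opposite i = trans (copies-product i) (cong₂ _·_ (tildeSign-↑ˡ i) (tildeSign-↑ʳ i))

    positiveCopySign : Fin n → Sign
    positiveCopySign i = ρ (i ↑ˡ n)

    private
      s = positiveCopySign

    pathSign-join : ∀ x → ρ (join n n x) ≡ s (reduce x) · copySign x
    pathSign-join (inj₁ i) = sym (*-identityʳ (s i))
    pathSign-join (inj₂ i) = x·y≡z⇒y≡x·z (s i) (ρ (n ↑ʳ i)) neg (copies-opposite i)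

    pathSign-flip : ∀ e → ρ (flip s e) ≡ π e
    pathSign-flip e = begin
      ρ (join n n (swapIf t x))                       ≡⟨ pathSign-join (swapIf t x) ⟩
      s (reduce (swapIf t x)) · copySign (swapIf t x) ≡⟨ cong₂ _·_ (cong s (reduce-swapIf t x)) (copySign-swapIf t x) ⟩
      t · (t · copySign x)                            ≡⟨ *-assoc t t (copySign x) ⟨
      (t · t) · copySign x                            ≡⟨ cong (_· copySign x) (s*s≡+ t) ⟩
      copySign x                                      ∎
      where
      x = splitAt n e
      t = s (reduce x)

mainTheorem4 : (H G : Graph) (σ : Fin (nE G) → Sign) →
    TopologicalMinor (tilde H) (tildeSign H) G σ ⇔ TotalTopologicalMinor (tilde H) (tildeSign H) G σ
mainTheorem4 H G σ = mk⇔ toTotal fromTotal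
  where
  open Tilde H

  fromTotal : TotalTopologicalMinor (tilde H) (tildeSign H) G σ → TopologicalMinor (tilde H) (tildeSign H) G σ
  fromTotal (M , total) = M , λ u C _ → signOf-cong total (edges (tilde H) C)

  toTotal : TopologicalMinor (tilde H) (tildeSign H) G σ → TotalTopologicalMinor (tilde H) (tildeSign H) G σ
  toTotal (M , cyc) = precompose , λ e → trans (pathSign-precompose σ e) (pathSign-flip σ M cyc e)
    where
    s = positiveCopySign σ M cyc
    open Precompose M (flip s) (flip-injective s) (src-flip s) (tgt-flip s)
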